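{- Let $\ell$ be a finite set with at least two elements, $\mathfrak B$ its Lyndon algebra, and $\vartheta$ an embedding of $\mathfrak B$ into a full coset relation algebra $\mathfrak C[\mathcal F]$ whose equivalence relation $\mathcal E$ is $I\times I$. Let $x,y\in I$ with $H_{xy}\ne\{e_x\}$. Then there is a unique point $p\in\ell$ such that $(G_x\times G_y)\cap\vartheta(p)\ne\varnothing$, and for this $p$, $(G_x\times G_y)\cup(G_y\times G_x)\subseteq\vartheta(p)$ and $(G_x\cup G_y)\times(G_x\cup G_y)\subseteq\vartheta(p+1')$.
   Context: Lyndon algebra: take $1'\notin\ell$, $\ell^+=\ell\cup\{1'\}$; Boolean part all subsets of $\ell^+$ (identify $p$ with $\{p\}$, so $p+1'=\{p,1'\}$); identity $1'$; converse the identity map; $p;q=\ell\setminus\{p,q\}$ for distinct $p,q\in\ell$, $p;p=p+1'$ for $p\in\ell$, $p;1'=1';p=p$, extended distributively. Full coset relation algebra: pairwise disjoint groups $\langle G_x:x\in I\rangle$ (operation $\circ$, identity $e_x$), $U=\bigcup_xG_x$; equivalence relation $\mathcal E$ on $I$; for $(x,y)\in\mathcal E$, $H_{xy}\trianglelefteq G_x$, $K_{xy}\trianglelefteq G_y$ and an isomorphism $\varphi_{xy}:G_x/H_{xy}\to G_y/K_{xy}$; cosets $H_{xy,\gamma}$ ($\gamma<\kappa_{xy}$, no repetition, $H_{xy,0}=H_{xy}$), $K_{xy,\gamma}=\varphi_{xy}(H_{xy,\gamma})$, $R_{xy,\alpha}=\bigcup_\gamma H_{xy,\gamma}\times(K_{xy,\gamma}\circ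 K_{xy,\alpha})$; $A$ = all unions of sets of such relations, unit $\bigcup_{(x,y)\in\mathcal E}G_x\times G_y$, assumed to contain $\mathrm{id}_U$ and be closed under converse and relational composition; cosets $C_{xyz}$ of $H_{xy}\circ H_{xz}$ in $G_x$ for $(x,y),(y,z)\in\mathcal E$; $R_{xy,\alpha}\otimes R_{yz,\beta}=\bigcup\{R_{xz,\gamma}:H_{xz,\gamma}\subseteq\varphi_{xy}^{ -1}[K_{xy,\alpha}\circ H_{yz,\beta}]\circ C_{xyz}\}$, $R_{xy,\alpha}\otimes R_{wz,\beta}=\varnothing$ for $y\ne w$, extended distributively; $\mathfrak C[\mathcal F]=(A,\cup,\sim,\otimes,{}^{ -1},\mathrm{id}_U)$ is assumed to be a relation algebra. An embedding is an injective relation-algebra homomorphism. -}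

module Defs where

open import Data.Nat using (ℕ; suc)
open import Data.Fin using (Fin; zero; suc; _≟_)
open import Data.Fin.Subset using (Subset; _∪_; ∁; ⁅_⁆)
open import Data.Vec using (Vec; lookup; tabulate)
open import Data.Bool using (Bool; true; false; _∧_; _∨_)
open import Data.Product using (Σ; Σ-syntax; _×_; _,_; proj₁)
open import Data.Sum using (_⊎_)
open import Relation.Nullary using (¬_; yes; no)
open import Relation.Binary.PropositionalEquality using (_≡_)

-- Lyndon algebra of ℓ = Fin n.
-- ℓ⁺ = Fin (suc n): the element  zero  plays the role of 1', and the
-- point p ∈ ℓ is  suc p .  Elements of the algebra: all subsets of ℓ⁺.

one' : ∀ {n} → Fin (suc n)
one' = zero

pt : ∀ {n} → Fin n → Subset (suc n)
pt p = ⁅ suc p ⁆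

atomComp : ∀ {n} → Fin (suc n) → Fin (suc n) → Subset (suc n)
atomComp zero    zero    = ⁅ zero ⁆
atomComp zero    (suc q) = ⁅ suc q ⁆
atomComp (suc p) zero    = ⁅ suc p ⁆
atomComp (suc p) (suc q) with p ≟ q
... | yes _ = ⁅ suc p ⁆ ∪ ⁅ zero ⁆
... | no  _ = ∁ (⁅ zero ⁆ ∪ (⁅ suc p ⁆ ∪ ⁅ suc q ⁆))

anyFin : ∀ {m} → (Fin m → Bool) → Bool
anyFin {ℕ.zero}  f = false
anyFin {suc m} f = f zero ∨ anyFin (λ i → f (suc i))

_⨾_ : ∀ {n} → Subset (suc n) → Subset (suc n) → Subset (suc n)
X ⨾ Y = tabulate λ r → anyFin λ p → anyFin λ q →
          lookup X p ∧ (lookup Y q ∧ lookup (atomComp p q) r)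

conv : ∀ {n} → Subset (suc n) → Subset (suc n)
conv X = X

record GroupE : Set₁ where
  field
    Carrier : Set
    _∙_     : Carrier → Carrier → Carrier
    e       : Carrier
    inv     : Carrier → Carrier
    assoc   : ∀ a b c → (a ∙ b) ∙ c ≡ a ∙ (b ∙ c)
    identityˡ : ∀ a → e ∙ a ≡ a
    identityʳ : ∀ a → a ∙ e ≡ a
    inverseˡ  : ∀ a → inv a ∙ a ≡ e
    inverseʳ  : ∀ a → a ∙ inv a ≡ e

open GroupE public using (Carrier)

record IsNormalSubgroup (G : GroupE) (H : Carrier G → Set) : Set where
  open GroupE G
  field
    e-∈     : H e
    ∙-∈     : ∀ {a b} → H a → H b → H (a ∙ b)
    inv-∈   : ∀ {a} → H a → H (inv a)
    normal  : ∀ g {a} → H a → H ((g ∙ a) ∙ inv g)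

-- An isomorphism φ : G/H → G'/K, given by its "graph lifted to elements":
-- Φ a b  means  b ∈ φ(a∘H).
record IsQuotientIso (G G' : GroupE) (H : Carrier G → Set) (K : Carrier G' → Set)
                     (Φ : Carrier G → Carrier G' → Set) : Set where
  module G  = GroupE G
  module G' = GroupE G'
  field
    image-nonempty : ∀ a → Σ[ b ∈ Carrier G' ] Φ a b
    image-coset    : ∀ {a b b'} → Φ a b → (Φ a b' → K (G'.inv b G'.∙ b'))
                                        × (K (G'.inv b G'.∙ b') → Φ a b')
    well-defined   : ∀ {a a' b} → Φ a b → H (G.inv a G.∙ a') → Φ a' b
    injective      : ∀ {a a' b} → Φ a b → Φ a' b → H (G.inv a G.∙ a')
    surjective     : ∀ b → Σ[ a ∈ Carrier G ] Φ a b
    homomorphic    : ∀ {a a' b b'} → Φ a b → Φ a' b' → Φ (a G.∙ a') (b G'.∙ b')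

-- Coset systems with equivalence relation  ℰ = I × I.
-- The groups G x are pairwise disjoint: U is their disjoint union (Σ-type).

record CosetSystem (I : Set) : Set₁ where
  field
    G   : I → GroupE
    H   : (x y : I) → Carrier (G x) → Set
    K   : (x y : I) → Carrier (G y) → Set
    H-normal : ∀ x y → IsNormalSubgroup (G x) (H x y)
    K-normal : ∀ x y → IsNormalSubgroup (G y) (K x y)
    Φ   : (x y : I) → Carrier (G x) → Carrier (G y) → Set
    Φ-iso : ∀ x y → IsQuotientIso (G x) (G y) (H x y) (K x y) (Φ x y)
    -- a representative of the chosen coset C_xyz of H_xy ∘ H_xz in G_x
    c   : (x y z : I) → Carrier (G x)

Rel : Set → Set₁
Rel U = U → U → Set

module _ {U : Set} where
  _⊆ᵣ_ : Rel U → Rel U → Set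
  R ⊆ᵣ S = ∀ u v → R u v → S u v

  _≐_ : Rel U → Rel U → Set
  R ≐ S = (R ⊆ᵣ S) × (S ⊆ᵣ R)

  _∪ᵣ_ : Rel U → Rel U → Rel U
  (R ∪ᵣ S) u v = R u v ⊎ S u v

  ∼ᵣ : Rel U → Rel U
  ∼ᵣ R u v = ¬ R u v

  _˘ : Rel U → Rel U
  (R ˘) u v = R v u

  _∣_ : Rel U → Rel U → Rel U
  (R ∣ S) u w = Σ[ v ∈ U ] (R u v × S v w)

  idᵣ : Rel U
  idᵣ u v = u ≡ v

module _ {I : Set} (F : CosetSystem I) where
  open CosetSystem F
  open GroupE

  U : Set
  U = Σ[ x ∈ I ] Carrier (G x)

  InCoset : ∀ {x} → (Carrier (G x) → Set) → Carrier (G x) → Carrier (G x) → Set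
  InCoset {x} N g a = N (_∙_ (G x) (inv (G x) g) a)

  -- the atom R_{xy,α}, where the coset H_{xy,α} = g ∘ H_xy :
  -- R_{xy,α} = { (a,b) ∈ G_x × G_y : b ∈ φ_xy((a ∘ g) ∘ H_xy) }
  Atom : (x y : I) → Carrier (G x) → Rel U
  Atom x y g u v = Σ[ a ∈ Carrier (G x) ] Σ[ b ∈ Carrier (G y) ]
                   (u ≡ (x , a)) × (v ≡ (y , b)) × Φ x y (_∙_ (G x) a g) b

  InC : (x y z : I) → Carrier (G x) → Set
  InC x y z a = Σ[ h₁ ∈ Carrier (G x) ] Σ[ h₂ ∈ Carrier (G x) ]
                H x y h₁ × H x z h₂ × (a ≡ _∙_ (G x) (c x y z) (_∙_ (G x) h₁ h₂))

  -- membership in  φ_xy⁻¹[K_{xy,α} ∘ H_{yz,β}] ∘ C_xyz,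
  -- with H_{xy,α} = gα ∘ H_xy (so K_{xy,α} = φ_xy(gα ∘ H_xy)) and H_{yz,β} = gβ ∘ H_yz
  InTarget : (x y z : I) → Carrier (G x) → Carrier (G y) → Carrier (G x) → Set
  InTarget x y z gα gβ a =
    Σ[ a₁ ∈ Carrier (G x) ] Σ[ c' ∈ Carrier (G x) ]
      (Σ[ b ∈ Carrier (G y) ]
         (Σ[ b₁ ∈ Carrier (G y) ] Σ[ b₂ ∈ Carrier (G y) ]
            Φ x y gα b₁ × InCoset (H y z) gβ b₂ × (b ≡ _∙_ (G y) b₁ b₂))
         × Φ x y a₁ b)
      × InC x y z c' × (a ≡ _∙_ (G x) a₁ c')

  Cond : (x y z : I) → Carrier (G x) → Carrier (G y) → Carrier (G x) → Set
  Cond x y z gα gβ gγ = ∀ a → InCoset (H x z) gγ a → InTarget x y z gα gβ a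

  _⊗_ : Rel U → Rel U → Rel U
  (R ⊗ S) u v = Σ[ x ∈ I ] Σ[ y ∈ I ] Σ[ z ∈ I ]
                Σ[ gα ∈ Carrier (G x) ] Σ[ gβ ∈ Carrier (G y) ] Σ[ gγ ∈ Carrier (G x) ]
                (Atom x y gα ⊆ᵣ R) × (Atom y z gβ ⊆ᵣ S) × Cond x y z gα gβ gγ
                × Atom x z gγ u v

  -- A: all unions of sets of atoms
  InA : Rel U → Set₁
  InA R = Σ[ S ∈ ((x y : I) → Carrier (G x) → Set) ]
            (∀ u v → (R u v → Σ[ x ∈ I ] Σ[ y ∈ I ] Σ[ g ∈ Carrier (G x) ] (S x y g × Atom x y g u v))
                   × (Σ[ x ∈ I ] Σ[ y ∈ I ] Σ[ g ∈ Carrier (G x) ] (S x y g × Atom x y g u v) → R u v))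

  record IsCosetRA : Set₁ where
    field
      id-∈A   : InA idᵣ
      ˘-∈A    : ∀ R → InA R → InA (R ˘)
      ∣-∈A    : ∀ R S → InA R → InA S → InA (R ∣ S)
      -- Tarski's axioms (those involving ⊗; the Boolean part is a field of sets)
      ∼∼      : ∀ R → InA R → ∼ᵣ (∼ᵣ R) ≐ R
      ⊗-assoc : ∀ R S T → InA R → InA S → InA T → ((R ⊗ S) ⊗ T) ≐ (R ⊗ (S ⊗ T))
      ⊗-distʳ : ∀ R S T → InA R → InA S → InA T → ((R ∪ᵣ S) ⊗ T) ≐ ((R ⊗ T) ∪ᵣ (S ⊗ T))
      ⊗-id    : ∀ R → InA R → (R ⊗ idᵣ) ≐ R
      ˘-⊗     : ∀ R S → InA R → InA S → ((R ⊗ S) ˘) ≐ ((S ˘) ⊗ (R ˘))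
      tarski  : ∀ R S → InA R → InA S → ((R ˘) ⊗ ∼ᵣ (R ⊗ S)) ⊆ᵣ ∼ᵣ S

  record IsEmbedding {n : ℕ} (θ : Subset (suc n) → Rel U) : Set₁ where
    field
      ∈A        : ∀ X → InA (θ X)
      pres-∪    : ∀ X Y → θ (X ∪ Y) ≐ (θ X ∪ᵣ θ Y)
      pres-∁    : ∀ X → θ (∁ X) ≐ ∼ᵣ (θ X)
      pres-⨾    : ∀ X Y → θ (X ⨾ Y) ≐ (θ X ⊗ θ Y)
      pres-conv : ∀ X → θ (conv X) ≐ (θ X ˘)
      pres-id   : θ ⁅ one' ⁆ ≐ idᵣ
      injective : ∀ X Y → θ X ≐ θ Y → X ≡ Y

  MeetsBlock : (x y : I) → Rel U → Set
  MeetsBlock x y R = Σ[ a ∈ Carrier (G x) ] Σ[ b ∈ Carrier (G y) ] R (x , a) (y , b)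

  InGxGy : (x y : I) → U → Set
  InGxGy x y u = (proj₁ u ≡ x) ⊎ (proj₁ u ≡ y)

-- The atoms 1' and p ∈ ℓ of the Lyndon algebra sum to its unit, so every pair of U lies in
-- θ(1') = id_U or in some θ(p). Since id_U is a union of atoms, H_xx = {e_x}; so H_xy ≠ {e_x}
-- forces x ≠ y and G_x × G_y meets some θ(p). If an atom R ⊆ θ(q) meets G_x × G_y, Tarski's law
-- puts an atom R_xx,g ⊆ id_U inside R ⊗ R˘, and translating its coset by some h ∈ H_xy ∖ {e_x}
-- keeps it inside R ⊗ R˘ ⊆ θ(q;q) = θ(q + 1') but moves it off the diagonal. The translated atom
-- is the same for every such q, so the θ(q) share a pair and q is unique; hence θ(p) ⊇ G_x × G_y.
-- A pair of G_x × G_x in θ(r) with r ≠ p would make θ(r) ⊗ θ(p) meet G_x × G_y ⊆ θ(p), although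
-- r;p = ℓ ∖ {r,p}. The classical steps are justified by the law ∼∼R = R of the algebra.

module Submission where

open import Defs
open import Data.Nat using (ℕ; suc; _≤_)
open import Data.Fin using (Fin; zero)
open import Data.Fin.Subset using (Subset; _∪_; ⁅_⁆)
open import Data.Product using (Σ; Σ-syntax; _×_; _,_)
open import Relation.Nullary using (¬_)
open import Relation.Binary.PropositionalEquality using (_≡_)

open import Algebra.Bundles using (Group)
import Algebra.Properties.Group as GroupProperties
open import Data.Bool using (Bool; true; false; _∧_)
open import Data.Empty using (⊥-elim)
open import Data.Fin using (suc; _≟_)
open import Data.Fin.Properties using (suc-injective)
open import Data.Fin.Subset using (_∈_; _⊆_; ∁; ⊤)
open import Data.Fin.Subset.Properties
open import Data.List using (List; []; _∷_; allFin)
open import Data.List.Membership.Propositional using () renaming (_∈_ to _∈ˡ_)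
open import Data.List.Membership.Propositional.Properties using (∈-allFin)
open import Data.List.Relation.Unary.Any using (here; there)
open import Data.Product using (proj₁; proj₂)
open import Data.Product.Properties.WithK using (,-injectiveʳ)
open import Data.Sum using (_⊎_; inj₁; inj₂; [_,_]′)
open import Data.Vec using (lookup; tabulate)
open import Data.Vec.Properties using (lookup∘tabulate; []=⇒lookup; lookup⇒[]=)
open import Function using (id)
open import Level using (0ℓ)
open import Relation.Nullary using (yes; no)
open import Relation.Nullary.Decidable using (decidable-stable)
open import Relation.Binary.PropositionalEquality
  using (refl; sym; trans; cong; cong₂; subst; isEquivalence; module ≡-Reasoning)

module GroupEProperties (G : GroupE) where
  open GroupE G public hiding (Carrier)
  open ≡-Reasoning

  group : Group 0ℓ 0ℓ
  group = record
    { Carrier = Carrier G ; _≈_ = _≡_ ; _∙_ = _∙_ ; ε = e ; _⁻¹ = inv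
    ; isGroup = record
      { isMonoid = record
        { isSemigroup = record
          { isMagma = record { isEquivalence = isEquivalence ; ∙-cong = cong₂ _∙_ }
          ; assoc = assoc }
        ; identity = identityˡ , identityʳ }
      ; inverse = inverseˡ , inverseʳ
      ; ⁻¹-cong = cong inv } }

  open GroupProperties group public
    using (⁻¹-involutive; ⁻¹-anti-homo-∙; identityʳ-unique; x∙y⁻¹≈ε⇒x≈y
          ; \\-leftDividesˡ; \\-leftDividesʳ; //-rightDividesˡ)

  conjugate≡e⇒≡e : ∀ g k → (g ∙ k) ∙ inv g ≡ e → k ≡ e
  conjugate≡e⇒≡e g k eq = identityʳ-unique g k (x∙y⁻¹≈ε⇒x≈y (g ∙ k) g eq)

  [x∙y]⁻¹∙[x∙z]≡y⁻¹∙z : ∀ x y z → inv (x ∙ y) ∙ (x ∙ z) ≡ inv y ∙ z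
  [x∙y]⁻¹∙[x∙z]≡y⁻¹∙z x y z = begin
    inv (x ∙ y) ∙ (x ∙ z)       ≡⟨ cong (_∙ (x ∙ z)) (⁻¹-anti-homo-∙ x y) ⟩
    (inv y ∙ inv x) ∙ (x ∙ z)   ≡⟨ assoc _ _ _ ⟩
    inv y ∙ (inv x ∙ (x ∙ z))   ≡⟨ cong (inv y ∙_) (\\-leftDividesʳ x z) ⟩
    inv y ∙ z                   ∎

  [x∙y]∙z≡[x∙[y∙z∙y⁻¹]]∙y : ∀ x y z → (x ∙ y) ∙ z ≡ (x ∙ ((y ∙ z) ∙ inv y)) ∙ y
  [x∙y]∙z≡[x∙[y∙z∙y⁻¹]]∙y x y z = begin
    (x ∙ y) ∙ z                    ≡⟨ assoc _ _ _ ⟩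
    x ∙ (y ∙ z)                    ≡⟨ cong (x ∙_) (sym (//-rightDividesˡ y (y ∙ z))) ⟩
    x ∙ (((y ∙ z) ∙ inv y) ∙ y)    ≡⟨ sym (assoc _ _ _) ⟩
    (x ∙ ((y ∙ z) ∙ inv y)) ∙ y    ∎

module NormalSubgroupProperties {G : GroupE} {N : Carrier G → Set}
                                (N-normal : IsNormalSubgroup G N) where
  open GroupEProperties G
  open IsNormalSubgroup N-normal public
  open ≡-Reasoning

  quotient-∙ʳ : ∀ {a b} z → N (inv a ∙ b) → N (inv (a ∙ z) ∙ (b ∙ z))
  quotient-∙ʳ {a} {b} z n = subst N conj≡ (normal (inv z) n)
    where
    conj≡ : (inv z ∙ (inv a ∙ b)) ∙ inv (inv z) ≡ inv (a ∙ z) ∙ (b ∙ z)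
    conj≡ = begin
      (inv z ∙ (inv a ∙ b)) ∙ inv (inv z) ≡⟨ cong ((inv z ∙ (inv a ∙ b)) ∙_) (⁻¹-involutive z) ⟩
      (inv z ∙ (inv a ∙ b)) ∙ z           ≡⟨ assoc _ _ _ ⟩
      inv z ∙ ((inv a ∙ b) ∙ z)           ≡⟨ cong (inv z ∙_) (assoc _ _ _) ⟩
      inv z ∙ (inv a ∙ (b ∙ z))           ≡⟨ sym (assoc _ _ _) ⟩
      (inv z ∙ inv a) ∙ (b ∙ z)           ≡⟨ cong (_∙ (b ∙ z)) (sym (⁻¹-anti-homo-∙ a z)) ⟩
      inv (a ∙ z) ∙ (b ∙ z)               ∎

  coset-∙⁻¹ : ∀ {g a} z → N (inv (g ∙ z) ∙ a) → N (inv g ∙ (a ∙ inv z))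
  coset-∙⁻¹ {g} {a} z n = subst N conj≡ (normal z n)
    where
    conj≡ : (z ∙ (inv (g ∙ z) ∙ a)) ∙ inv z ≡ inv g ∙ (a ∙ inv z)
    conj≡ = begin
      (z ∙ (inv (g ∙ z) ∙ a)) ∙ inv z      ≡⟨ cong (λ t → (z ∙ (t ∙ a)) ∙ inv z) (⁻¹-anti-homo-∙ g z) ⟩
      (z ∙ ((inv z ∙ inv g) ∙ a)) ∙ inv z  ≡⟨ cong (λ t → (z ∙ t) ∙ inv z) (assoc _ _ _) ⟩
      (z ∙ (inv z ∙ (inv g ∙ a))) ∙ inv z  ≡⟨ cong (_∙ inv z) (\\-leftDividesˡ z _) ⟩
      (inv g ∙ a) ∙ inv z                  ≡⟨ assoc _ _ _ ⟩
      inv g ∙ (a ∙ inv z)                  ∎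

∧≡true⁻ : ∀ {a b} → a ∧ b ≡ true → a ≡ true × b ≡ true
∧≡true⁻ {true} {true} refl = refl , refl

anyFin≡true⁻ : ∀ {m} (f : Fin m → Bool) → anyFin f ≡ true → Σ[ i ∈ Fin m ] f i ≡ true
anyFin≡true⁻ {suc m} f eq with f zero in f0≡true
... | true  = zero , f0≡true
... | false = let (i , fi≡true) = anyFin≡true⁻ (λ i → f (suc i)) eq in suc i , fi≡true

⨾-witness : ∀ {n} → Subset (suc n) → Subset (suc n) → (r p q : Fin (suc n)) → Bool
⨾-witness X Y r p q = lookup X p ∧ (lookup Y q ∧ lookup (atomComp p q) r)

∈-⨾⁻ : ∀ {n} (X Y : Subset (suc n)) {r} → r ∈ X ⨾ Y
     → Σ[ p ∈ Fin (suc n) ] Σ[ q ∈ Fin (suc n) ] p ∈ X × q ∈ Y × r ∈ atomComp p q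
∈-⨾⁻ X Y {r} r∈X⨾Y
  with anyFin≡true⁻ (λ p → anyFin (⨾-witness X Y r p))
         (trans (sym (lookup∘tabulate (λ s → anyFin λ p → anyFin (⨾-witness X Y s p)) r))
                ([]=⇒lookup r∈X⨾Y))
... | p , any≡true with anyFin≡true⁻ _ any≡true
... | q , all≡true with ∧≡true⁻ {lookup X p} all≡true
... | p∈X , rest with ∧≡true⁻ {lookup Y q} rest
... | q∈Y , r∈pq = p , q , lookup⇒[]= p X p∈X , lookup⇒[]= q Y q∈Y , lookup⇒[]= r (atomComp p q) r∈pq

atomComp-≡ : ∀ {n} {p q : Fin n} → p ≡ q → atomComp (suc p) (suc q) ≡ pt p ∪ ⁅ one' ⁆
atomComp-≡ {p = p} {q} p≡q with p ≟ q
... | yes _   = refl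
... | no p≢q = ⊥-elim (p≢q p≡q)

atomComp-≢ : ∀ {n} {p q : Fin n} → ¬ p ≡ q
           → atomComp (suc p) (suc q) ≡ ∁ (⁅ one' ⁆ ∪ (pt p ∪ pt q))
atomComp-≢ {p = p} {q} p≢q with p ≟ q
... | yes p≡q = ⊥-elim (p≢q p≡q)
... | no _    = refl

pt⨾pt⊆pt∪one' : ∀ {n} (p : Fin n) → pt p ⨾ pt p ⊆ pt p ∪ ⁅ one' ⁆
pt⨾pt⊆pt∪one' p {r} r∈ with ∈-⨾⁻ (pt p) (pt p) r∈
... | p' , q' , p'∈ , q'∈ , r∈p'q' with x∈⁅y⁆⇒x≡y (suc p) p'∈ | x∈⁅y⁆⇒x≡y (suc p) q'∈
... | refl | refl = subst (r ∈_) (atomComp-≡ refl) r∈p'q'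

pt⨾pt⊆∁pt : ∀ {n} {r p : Fin n} → ¬ r ≡ p → pt r ⨾ pt p ⊆ ∁ (pt p)
pt⨾pt⊆∁pt {r = r} {p} r≢p {s} s∈ with ∈-⨾⁻ (pt r) (pt p) s∈
... | r' , p' , r'∈ , p'∈ , s∈r'p' with x∈⁅y⁆⇒x≡y (suc r) r'∈ | x∈⁅y⁆⇒x≡y (suc p) p'∈
... | refl | refl = x∉p⇒x∈∁p λ s∈p →
  x∈∁p⇒x∉p (subst (s ∈_) (atomComp-≢ r≢p) s∈r'p')
            (x∈p∪q⁺ (inj₂ (x∈p∪q⁺ {p = pt r} (inj₂ s∈p))))

pt⊆∁pt : ∀ {n} {q p : Fin n} → ¬ q ≡ p → pt q ⊆ ∁ (pt p)
pt⊆∁pt {q = q} q≢p s∈ with x∈⁅y⁆⇒x≡y (suc q) s∈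
... | refl = x∉p⇒x∈∁p λ s∈p → q≢p (suc-injective (x∈⁅y⁆⇒x≡y (suc _) s∈p))

atoms : ∀ {n} → List (Fin n) → Subset (suc n)
atoms []       = ⁅ one' ⁆
atoms (q ∷ qs) = pt q ∪ atoms qs

one'∈atoms : ∀ {n} (qs : List (Fin n)) → one' ∈ atoms qs
one'∈atoms []       = x∈⁅x⁆ _
one'∈atoms (q ∷ qs) = x∈p∪q⁺ (inj₂ (one'∈atoms qs))

pt∈atoms : ∀ {n} {q} {qs : List (Fin n)} → q ∈ˡ qs → suc q ∈ atoms qs
pt∈atoms (here refl) = x∈p∪q⁺ (inj₁ (x∈⁅x⁆ _))
pt∈atoms (there q∈)  = x∈p∪q⁺ (inj₂ (pt∈atoms q∈))

⊤⊆atoms-allFin : ∀ {n} → ⊤ ⊆ atoms (allFin n)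
⊤⊆atoms-allFin {n} {zero}  _ = one'∈atoms (allFin n)
⊤⊆atoms-allFin {n} {suc q} _ = pt∈atoms (∈-allFin q)

p⊆q⇒p∪q≡q : ∀ {n} {p q : Subset n} → p ⊆ q → p ∪ q ≡ q
p⊆q⇒p∪q≡q {p = p} {q} p⊆q =
  ⊆-antisym (λ x∈ → [ p⊆q , id ]′ (x∈p∪q⁻ p q x∈)) (q⊆p∪q p q)

module CosetSystemProperties {I : Set} (F : CosetSystem I) where
  open CosetSystem F
  open ≡-Reasoning
  module Gr (z : I) = GroupEProperties (G z)
  module H⊴ (x y : I) = NormalSubgroupProperties (H-normal x y)
  module φ (x y : I) = IsQuotientIso (Φ-iso x y)

  mul : (z : I) → Carrier (G z) → Carrier (G z) → Carrier (G z)
  mul = Gr._∙_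

  e : (z : I) → Carrier (G z)
  e = Gr.e

  inv : (z : I) → Carrier (G z) → Carrier (G z)
  inv = Gr.inv

  infixl 7 _⊗ᶠ_
  _⊗ᶠ_ : Rel (U F) → Rel (U F) → Rel (U F)
  _⊗ᶠ_ = _⊗_ F

  ⊗-mono : ∀ {R R′ S S′} → R ⊆ᵣ R′ → S ⊆ᵣ S′ → (R ⊗ᶠ S) ⊆ᵣ (R′ ⊗ᶠ S′)
  ⊗-mono R⊆R′ S⊆S′ u v (x , y , z , gα , gβ , gγ , α⊆R , β⊆S , cond , uv∈γ) =
    x , y , z , gα , gβ , gγ , (λ s t st∈ → R⊆R′ s t (α⊆R s t st∈))
                            , (λ s t st∈ → S⊆S′ s t (β⊆S s t st∈)) , cond , uv∈γ

  atom-at : ∀ {x y g a b} → Φ x y (mul x a g) b → Atom F x y g (x , a) (y , b)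
  atom-at {a = a} {b} φab = a , b , refl , refl , φab

  atom-at-e : ∀ {x y g b} → Φ x y g b → Atom F x y g (x , e x) (y , b)
  atom-at-e {x} {y} {g} {b} φgb = atom-at (subst (λ t → Φ x y t b) (sym (Gr.identityˡ x g)) φgb)

  Atom-∈A : ∀ x y g → InA F (Atom F x y g)
  Atom-∈A x y g =
    (λ x′ y′ g′ → Atom F x′ y′ g′ ⊆ᵣ Atom F x y g) ,
    λ u v → (λ uv∈ → x , y , g , (λ _ _ st∈ → st∈) , uv∈) ,
            (λ { (_ , _ , _ , atom⊆ , uv∈) → atom⊆ u v uv∈ })

  atom-through : ∀ {R} → InA F R → ∀ {u v} → R u v
    → Σ[ x ∈ I ] Σ[ y ∈ I ] Σ[ g ∈ Carrier (G x) ] Atom F x y g u v × Atom F x y g ⊆ᵣ R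
  atom-through (S , R≐⋃S) {u} {v} uv∈R with proj₁ (R≐⋃S u v) uv∈R
  ... | x , y , g , g∈S , uv∈ =
    x , y , g , uv∈ , λ s t st∈ → proj₂ (R≐⋃S s t) (x , y , g , g∈S , st∈)

  common-pair⇒Atom⊆Atom : ∀ {x y g g′ a b} → Φ x y (mul x a g) b → Φ x y (mul x a g′) b
                         → Atom F x y g ⊆ᵣ Atom F x y g′
  common-pair⇒Atom⊆Atom {x} {y} {g} {g′} {a} φ φ′ _ _ (a₂ , b₂ , refl , refl , φ₂) =
    atom-at (φ.well-defined x y φ₂ (subst (H x y) translate (φ.injective x y φ φ′)))
    where
    translate : mul x (inv x (mul x a g)) (mul x a g′) ≡ mul x (inv x (mul x a₂ g)) (mul x a₂ g′)
    translate = trans (Gr.[x∙y]⁻¹∙[x∙z]≡y⁻¹∙z x a g g′) (sym (Gr.[x∙y]⁻¹∙[x∙z]≡y⁻¹∙z x a₂ g g′))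

  InC-∙ʳ : ∀ {x y z c′ h} → H x y h → InC F x y z c′ → InC F x y z (mul x c′ h)
  InC-∙ʳ {x} {y} {z} {c′} {h} h∈H (h₁ , h₂ , h₁∈H , h₂∈H , c′≡) =
    mul x h₁ (mul x (mul x h₂ h) (inv x h₂)) , h₂ ,
    H⊴.∙-∈ x y h₁∈H (H⊴.normal x y h₂ h∈H) , h₂∈H , c′h≡
    where
    open Gr x hiding (inv; e)
    c′h≡ : c′ ∙ h ≡ c x y z ∙ ((h₁ ∙ ((h₂ ∙ h) ∙ inv x h₂)) ∙ h₂)
    c′h≡ = begin
      c′ ∙ h                                    ≡⟨ cong (_∙ h) c′≡ ⟩
      (c x y z ∙ (h₁ ∙ h₂)) ∙ h                 ≡⟨ assoc _ _ _ ⟩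
      c x y z ∙ ((h₁ ∙ h₂) ∙ h)                 ≡⟨ cong (c x y z ∙_) ([x∙y]∙z≡[x∙[y∙z∙y⁻¹]]∙y h₁ h₂ h) ⟩
      c x y z ∙ ((h₁ ∙ ((h₂ ∙ h) ∙ inv x h₂)) ∙ h₂) ∎

  Cond-∙ʳ : ∀ {x y z gα gβ gγ h} → H x y h → Cond F x y z gα gβ gγ → Cond F x y z gα gβ (mul x gγ h)
  Cond-∙ʳ {x} {z = z} {h = h} h∈H cond a a∈ with cond (mul x a (inv x h)) (H⊴.coset-∙⁻¹ x z h a∈)
  ... | a₁ , c′ , a₁∈ , c′∈C , a∙h⁻¹≡ = a₁ , mul x c′ h , a₁∈ , InC-∙ʳ h∈H c′∈C , a≡
    where
    open Gr x hiding (inv; e)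
    a≡ : a ≡ a₁ ∙ (c′ ∙ h)
    a≡ = begin
      a                    ≡⟨ sym (//-rightDividesˡ h a) ⟩
      (a ∙ inv x h) ∙ h    ≡⟨ cong (_∙ h) a∙h⁻¹≡ ⟩
      (a₁ ∙ c′) ∙ h        ≡⟨ assoc _ _ _ ⟩
      a₁ ∙ (c′ ∙ h)        ∎

  -- gβ = b₁⁻¹ b with b₁ ∈ φ(gα) and b ∈ φ(gγ c⁻¹) puts gγ c⁻¹ into φ⁻¹[K_α ∘ H_β], and every
  -- a ∈ gγ H_xz is (gγ c⁻¹)(c (e ∙ gγ⁻¹ a)) with the second factor in C_xyz.
  Cond-solvable : ∀ x y z gα gγ → Σ[ gβ ∈ Carrier (G y) ] Cond F x y z gα gβ gγ
  Cond-solvable x y z gα gγ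
    with φ.image-nonempty x y (mul x gγ (inv x (c x y z))) | φ.image-nonempty x y gα
  ... | b , φb | b₁ , φb₁ =
    b₂ , λ a a∈ →
      gγ ∙ inv x (c x y z) , c x y z ∙ (e x ∙ (inv x gγ ∙ a)) ,
      (b , (b₁ , b₂ , φb₁ , b₂∈b₂H , sym (Gr.\\-leftDividesˡ y b₁ b)) , φb) ,
      (e x , inv x gγ ∙ a , H⊴.e-∈ x y , a∈ , refl) , a≡ a
    where
    open Gr x hiding (inv; e)
    b₂ : Carrier (G y)
    b₂ = mul y (inv y b₁) b
    b₂∈b₂H : H y z (mul y (inv y b₂) b₂)
    b₂∈b₂H = subst (H y z) (sym (Gr.inverseˡ y b₂)) (H⊴.e-∈ y z)
    a≡ : ∀ a → a ≡ (gγ ∙ inv x (c x y z)) ∙ (c x y z ∙ (e x ∙ (inv x gγ ∙ a)))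
    a≡ a = sym (begin
      (gγ ∙ inv x (c x y z)) ∙ (c x y z ∙ (e x ∙ (inv x gγ ∙ a)))
        ≡⟨ cong (λ t → (gγ ∙ inv x (c x y z)) ∙ (c x y z ∙ t)) (identityˡ _) ⟩
      (gγ ∙ inv x (c x y z)) ∙ (c x y z ∙ (inv x gγ ∙ a))
        ≡⟨ assoc _ _ _ ⟩
      gγ ∙ (inv x (c x y z) ∙ (c x y z ∙ (inv x gγ ∙ a)))
        ≡⟨ cong (gγ ∙_) (\\-leftDividesʳ (c x y z) _) ⟩
      gγ ∙ (inv x gγ ∙ a)
        ≡⟨ \\-leftDividesˡ gγ a ⟩
      a ∎)

  ⊗-meets-block : ∀ {R S z w a a′} → InA F R → R (z , a) (z , a′)
    → (∀ a b → S (z , a) (w , b)) → MeetsBlock F z w (R ⊗ᶠ S)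
  ⊗-meets-block {S = S} {z} {w} R∈A zz∈R S⊇block with atom-through R∈A zz∈R
  ... | _ , _ , g , (_ , _ , refl , refl , _) , atom⊆R
    with Cond-solvable z z w g (e z) | φ.image-nonempty z w (e z)
  ... | gβ , cond | b , φb =
    e z , b , z , z , w , g , gβ , e z , atom⊆R , β⊆S , cond , atom-at-e φb
    where
    β⊆S : Atom F z w gβ ⊆ᵣ S
    β⊆S _ _ (a₁ , b₁ , refl , refl , _) = S⊇block a₁ b₁

  ShiftedIdentity : (x : I) → Carrier (G x) → Rel (U F) → Set
  ShiftedIdentity x h R =
    Σ[ g ∈ Carrier (G x) ] Atom F x x g ⊆ᵣ idᵣ × Atom F x x (mul x g h) ⊆ᵣ R

  ShiftedIdentity-mono : ∀ {x h R R′} → R ⊆ᵣ R′ → ShiftedIdentity x h R → ShiftedIdentity x h R′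
  ShiftedIdentity-mono R⊆R′ (g , g⊆id , gh⊆R) = g , g⊆id , λ u v uv∈ → R⊆R′ u v (gh⊆R u v uv∈)

  module RelationAlgebraProperties (RA : IsCosetRA F) where
    open IsCosetRA RA

    diagonal-atom⊆id : ∀ {z g a} → Atom F z z g (z , a) (z , a) → Atom F z z g ⊆ᵣ idᵣ
    diagonal-atom⊆id {z} {a = a} (_ , _ , refl , refl , φ) with atom-through id-∈A {z , a} {z , a} refl
    ... | _ , _ , _ , (_ , _ , refl , refl , φ′) , atom⊆id =
      λ u v uv∈ → atom⊆id u v (common-pair⇒Atom⊆Atom φ φ′ u v uv∈)

    atom⊆id⇒Φ-e : ∀ {z g} → Atom F z z g ⊆ᵣ idᵣ → Φ z z g (e z)
    atom⊆id⇒Φ-e {z} {g} atom⊆id with φ.image-nonempty z z g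
    ... | b , φgb with atom⊆id _ _ (atom-at-e φgb)
    ... | refl = φgb

    -- id_U contains an atom R_zz,g through (e, e), and k ∈ H_zz puts ((g k) g⁻¹, e) into it too.
    H-diagonal-trivial : ∀ z {k} → H z z k → k ≡ e z
    H-diagonal-trivial z {k} k∈H with atom-through id-∈A {z , e z} {z , e z} refl
    ... | _ , _ , g , atom∋ee@(_ , _ , refl , refl , _) , atom⊆id =
      Gr.conjugate≡e⇒≡e z g k (,-injectiveʳ (atom⊆id _ _ (atom-at φgkg⁻¹g)))
      where
      open Gr z hiding (inv; e)
      φg : Φ z z g (e z)
      φg = atom⊆id⇒Φ-e (diagonal-atom⊆id atom∋ee)
      φgk : Φ z z (g ∙ k) (e z)
      φgk = φ.well-defined z z φg (subst (H z z) (sym (\\-leftDividesʳ g k)) k∈H)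
      φgkg⁻¹g : Φ z z (((g ∙ k) ∙ inv z g) ∙ g) (e z)
      φgkg⁻¹g = subst (λ t → Φ z z t (e z)) (sym (//-rightDividesˡ g (g ∙ k))) φgk

    nontrivial-H⇒off-diagonal : ∀ {x y h} → H x y h → ¬ h ≡ e x
      → ∀ {a b} → ¬ _≡_ {A = U F} (x , a) (y , b)
    nontrivial-H⇒off-diagonal {x} h∈H h≢e refl = h≢e (H-diagonal-trivial x h∈H)

    -- Tarski's law R˘ ⊗ ∼(R ⊗ R˘) ⊆ ∼R˘ at (v, u) ∈ R˘ = R˘ ⊗ id_U.
    ¬¬⊗˘-meets-diagonal : ∀ {R} → InA F R → ∀ {u v} → R u v → ¬ ¬ (Σ[ s ∈ U F ] (R ⊗ᶠ R ˘) s s)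
    ¬¬⊗˘-meets-diagonal {R} R∈A {u} {v} uv∈R no-diagonal
      with proj₂ (⊗-id (R ˘) (˘-∈A R R∈A)) v u uv∈R
    ... | x , y , z , gα , gβ , gγ , α⊆R˘ , β⊆id , cond , vu∈γ =
      tarski R (R ˘) R∈A (˘-∈A R R∈A) v u
             (x , y , z , gα , gβ , gγ , α⊆R˘ , β⊆∼R⊗R˘ , cond , vu∈γ) uv∈R
      where
      β⊆∼R⊗R˘ : Atom F y z gβ ⊆ᵣ ∼ᵣ (R ⊗ᶠ R ˘)
      β⊆∼R⊗R˘ s t st∈β st∈R⊗R˘ with β⊆id s t st∈β
      ... | refl = no-diagonal (s , st∈R⊗R˘)

    ⊗˘-diagonal⇒ShiftedIdentity : ∀ {x y g h} → H x y h
      → Σ[ s ∈ U F ] (Atom F x y g ⊗ᶠ Atom F x y g ˘) s s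
      → ShiftedIdentity x h (Atom F x y g ⊗ᶠ Atom F x y g ˘)
    ⊗˘-diagonal⇒ShiftedIdentity {x} {y} {h = h} h∈H
      (_ , x₁ , y₁ , z₁ , gα , gβ , gγ , α⊆R , β⊆R˘ , cond , ss∈γ)
      with φ.image-nonempty x₁ y₁ gα
    ... | b , φb with α⊆R _ _ (atom-at-e φb) | ss∈γ
    ... | (_ , _ , refl , refl , _) | (a , _ , refl , refl , φa) =
      gγ , diagonal-atom⊆id (atom-at φa) ,
      λ u v uv∈ → x , y , x , gα , gβ , mul x gγ h , α⊆R , β⊆R˘ , Cond-∙ʳ h∈H cond , uv∈

    ShiftedIdentity-common-pair : ∀ {x h R R′} → ¬ h ≡ e x
      → ShiftedIdentity x h R → ShiftedIdentity x h R′
      → Σ[ b ∈ Carrier (G x) ] ¬ _≡_ {A = U F} (x , e x) (x , b)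
                               × R (x , e x) (x , b) × R′ (x , e x) (x , b)
    ShiftedIdentity-common-pair {x} {h} h≢e (g , g⊆id , gh⊆R) (g′ , g′⊆id , g′h⊆R′)
      with φ.image-nonempty x x (mul x g h)
    ... | b , φghb = b , off-diagonal , gh⊆R _ _ (atom-at-e φghb) , g′h⊆R′ _ _ (atom-at-e φg′hb)
      where
      open Gr x hiding (inv; e)
      φg : Φ x x g (e x)
      φg = atom⊆id⇒Φ-e g⊆id
      φg′hb : Φ x x (g′ ∙ h) b
      φg′hb = φ.well-defined x x φghb
                (H⊴.quotient-∙ʳ x x h (φ.injective x x φg (atom⊆id⇒Φ-e g′⊆id)))
      off-diagonal : ¬ _≡_ {A = U F} (x , e x) (x , b)
      off-diagonal eb = h≢e (H-diagonal-trivial x (subst (H x x) (\\-leftDividesʳ g h)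
        (φ.injective x x φg (subst (Φ x x (g ∙ h)) (sym (,-injectiveʳ eb)) φghb))))

    module EmbeddingProperties {n : ℕ} {θ : Subset (suc n) → Rel (U F)} (E : IsEmbedding F θ) where
      open IsEmbedding E

      θ-stable : ∀ X {u v} → ¬ ¬ θ X u v → θ X u v
      θ-stable X {u} {v} = proj₁ (∼∼ (θ X) (∈A X)) u v

      θ-sym : ∀ X {u v} → θ X u v → θ X v u
      θ-sym X {u} {v} = proj₁ (pres-conv X) u v

      θ-∪⁺ˡ : ∀ X Y {u v} → θ X u v → θ (X ∪ Y) u v
      θ-∪⁺ˡ X Y {u} {v} uv∈ = proj₂ (pres-∪ X Y) u v (inj₁ uv∈)

      θ-∪⁺ʳ : ∀ X Y {u v} → θ Y u v → θ (X ∪ Y) u v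
      θ-∪⁺ʳ X Y {u} {v} uv∈ = proj₂ (pres-∪ X Y) u v (inj₂ uv∈)

      θ-∪⁻ : ∀ X Y {u v} → θ (X ∪ Y) u v → θ X u v ⊎ θ Y u v
      θ-∪⁻ X Y {u} {v} = proj₁ (pres-∪ X Y) u v

      θ-mono : ∀ {X Y} → X ⊆ Y → ∀ {u v} → θ X u v → θ Y u v
      θ-mono {X} {Y} X⊆Y {u} {v} uv∈ = subst (λ Z → θ Z u v) (p⊆q⇒p∪q≡q X⊆Y) (θ-∪⁺ˡ X Y uv∈)

      θ-one'⇒≡ : ∀ {u v} → θ ⁅ one' ⁆ u v → u ≡ v
      θ-one'⇒≡ {u} {v} = proj₁ pres-id u v

      θ-⊤ : ∀ u v → θ ⊤ u v
      θ-⊤ u v = θ-stable ⊤ λ uv∉θ⊤ → uv∉θ⊤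
        (subst (λ Z → θ Z u v) (p∪∁p≡⊤ ⊤) (θ-∪⁺ʳ ⊤ (∁ ⊤) (proj₂ (pres-∁ ⊤) u v uv∉θ⊤)))

      θ-atoms⁻ : ∀ qs {u v} → θ (atoms qs) u v → θ ⁅ one' ⁆ u v ⊎ Σ[ q ∈ Fin n ] θ (pt q) u v
      θ-atoms⁻ []       uv∈ = inj₁ uv∈
      θ-atoms⁻ (q ∷ qs) uv∈ with θ-∪⁻ (pt q) (atoms qs) uv∈
      ... | inj₁ uv∈q  = inj₂ (q , uv∈q)
      ... | inj₂ uv∈qs = θ-atoms⁻ qs uv∈qs

      θ-one'-or-pt : ∀ u v → θ ⁅ one' ⁆ u v ⊎ Σ[ q ∈ Fin n ] θ (pt q) u v
      θ-one'-or-pt u v = θ-atoms⁻ (allFin n) (θ-mono ⊤⊆atoms-allFin (θ-⊤ u v))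

      θ-pt-disjoint : ∀ {p q u v} → θ (pt p) u v → θ (pt q) u v → q ≡ p
      θ-pt-disjoint {p} {q} {u} {v} uv∈p uv∈q with q ≟ p
      ... | yes q≡p = q≡p
      ... | no q≢p  = ⊥-elim (proj₁ (pres-∁ (pt p)) u v (θ-mono (pt⊆∁pt q≢p) uv∈q) uv∈p)

      θ-pt⊗pt-off-diagonal : ∀ {q u v} → (θ (pt q) ⊗ᶠ θ (pt q)) u v → ¬ u ≡ v → θ (pt q) u v
      θ-pt⊗pt-off-diagonal {q} {u} {v} uv∈ u≢v
        with θ-∪⁻ (pt q) ⁅ one' ⁆ (θ-mono (pt⨾pt⊆pt∪one' q) (proj₂ (pres-⨾ (pt q) (pt q)) u v uv∈))
      ... | inj₁ uv∈q    = uv∈q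
      ... | inj₂ uv∈one' = ⊥-elim (u≢v (θ-one'⇒≡ uv∈one'))

      θ-pt⊗pt-excludes : ∀ {r p u v} → (θ (pt r) ⊗ᶠ θ (pt p)) u v → θ (pt p) u v → r ≡ p
      θ-pt⊗pt-excludes {r} {p} {u} {v} uv∈rp uv∈p with r ≟ p
      ... | yes r≡p = r≡p
      ... | no r≢p  = ⊥-elim (proj₁ (pres-∁ (pt p)) u v
                        (θ-mono (pt⨾pt⊆∁pt r≢p) (proj₂ (pres-⨾ (pt r) (pt p)) u v uv∈rp)) uv∈p)

      full-block⇒square⊆pt∪one' : ∀ {p z w} → (∀ a b → θ (pt p) (z , a) (w , b))
        → ∀ a a′ → θ (pt p ∪ ⁅ one' ⁆) (z , a) (z , a′)
      full-block⇒square⊆pt∪one' {p} block a a′ with θ-one'-or-pt (_ , a) (_ , a′)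
      ... | inj₁ aa′∈one' = θ-∪⁺ʳ (pt p) ⁅ one' ⁆ aa′∈one'
      ... | inj₂ (r , aa′∈r) with ⊗-meets-block (∈A (pt r)) aa′∈r block
      ... | a₀ , b₀ , a₀b₀∈rp with θ-pt⊗pt-excludes a₀b₀∈rp (block a₀ b₀)
      ... | refl = θ-∪⁺ˡ (pt p) ⁅ one' ⁆ aa′∈r

      module NontrivialBlock {x y : I} {h : Carrier (G x)} (h∈H : H x y h) (h≢e : ¬ h ≡ e x) where

        ¬θ-one' : ∀ {a b} → ¬ θ ⁅ one' ⁆ (x , a) (y , b)
        ¬θ-one' ab∈one' = nontrivial-H⇒off-diagonal h∈H h≢e (θ-one'⇒≡ ab∈one')

        meets⇒¬¬ShiftedIdentity : ∀ q → MeetsBlock F x y (θ (pt q))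
          → ¬ ¬ ShiftedIdentity x h (θ (pt q) ⊗ᶠ θ (pt q))
        meets⇒¬¬ShiftedIdentity q (a , b , ab∈q) ¬shifted
          with atom-through (∈A (pt q)) ab∈q
        ... | _ , _ , g , ab∈atom@(_ , _ , refl , refl , _) , atom⊆q =
          ¬¬⊗˘-meets-diagonal (Atom-∈A x y g) ab∈atom λ diagonal →
            ¬shifted (ShiftedIdentity-mono (⊗-mono atom⊆q atom˘⊆q)
                                           (⊗˘-diagonal⇒ShiftedIdentity h∈H diagonal))
          where
          atom˘⊆q : (Atom F x y g ˘) ⊆ᵣ θ (pt q)
          atom˘⊆q u v vu∈ = θ-sym (pt q) (atom⊆q v u vu∈)

        meets-unique : ∀ {p q} → MeetsBlock F x y (θ (pt p)) → MeetsBlock F x y (θ (pt q)) → q ≡ p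
        meets-unique {p} {q} meets-p meets-q = decidable-stable (q ≟ p) λ q≢p →
          meets⇒¬¬ShiftedIdentity p meets-p λ shifted-p →
          meets⇒¬¬ShiftedIdentity q meets-q λ shifted-q →
          let (_ , off , ∈p⊗p , ∈q⊗q) = ShiftedIdentity-common-pair h≢e shifted-p shifted-q
          in q≢p (θ-pt-disjoint (θ-pt⊗pt-off-diagonal ∈p⊗p off) (θ-pt⊗pt-off-diagonal ∈q⊗q off))

        point : Σ[ p ∈ Fin n ] MeetsBlock F x y (θ (pt p))
        point with θ-one'-or-pt (x , e x) (y , e y)
        ... | inj₁ ∈one'    = ⊥-elim (¬θ-one' ∈one')
        ... | inj₂ (p , ∈p) = p , e x , e y , ∈p

        p : Fin n
        p = proj₁ point

        meets-p : MeetsBlock F x y (θ (pt p))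
        meets-p = proj₂ point

        block⊆θp : ∀ a b → θ (pt p) (x , a) (y , b)
        block⊆θp a b with θ-one'-or-pt (x , a) (y , b)
        ... | inj₁ ∈one'    = ⊥-elim (¬θ-one' ∈one')
        ... | inj₂ (q , ∈q) = subst (λ r → θ (pt r) (x , a) (y , b)) (meets-unique meets-p (a , b , ∈q)) ∈q

        square⊆θp∪one' : ∀ u v → InGxGy F x y u → InGxGy F x y v → θ (pt p ∪ ⁅ one' ⁆) u v
        square⊆θp∪one' (_ , a) (_ , b) (inj₁ refl) (inj₁ refl) = full-block⇒square⊆pt∪one' block⊆θp a b
        square⊆θp∪one' (_ , a) (_ , b) (inj₁ refl) (inj₂ refl) = θ-∪⁺ˡ (pt p) ⁅ one' ⁆ (block⊆θp a b)
        square⊆θp∪one' (_ , a) (_ , b) (inj₂ refl) (inj₁ refl) =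
          θ-∪⁺ˡ (pt p) ⁅ one' ⁆ (θ-sym (pt p) (block⊆θp b a))
        square⊆θp∪one' (_ , a) (_ , b) (inj₂ refl) (inj₂ refl) =
          full-block⇒square⊆pt∪one' (λ a b → θ-sym (pt p) (block⊆θp b a)) a b

lemma4p1 : (n : ℕ) → 2 ≤ n → (I : Set) → (F : CosetSystem I) → IsCosetRA F
    → (θ : Subset (suc n) → Rel (U F)) → IsEmbedding F θ
    → (x y : I)
    → Σ[ h ∈ Carrier (CosetSystem.G F x) ]
        (CosetSystem.H F x y h × ¬ (h ≡ GroupE.e (CosetSystem.G F x)))
    → Σ[ p ∈ Fin n ]
        ( MeetsBlock F x y (θ (pt p))
        × (∀ q → MeetsBlock F x y (θ (pt q)) → q ≡ p)
        × (∀ a b → θ (pt p) (x , a) (y , b) × θ (pt p) (y , b) (x , a))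
        × (∀ u v → InGxGy F x y u → InGxGy F x y v → θ (pt p ∪ ⁅ one' ⁆) u v) )
lemma4p1 n _ I F RA θ E x y (_ , h∈H , h≢e) =
  p , meets-p , (λ q → meets-unique meets-p) ,
  (λ a b → block⊆θp a b , θ-sym (pt p) (block⊆θp a b)) , square⊆θp∪one'
  where
  open CosetSystemProperties F
  open RelationAlgebraProperties RA
  open EmbeddingProperties E
  open NontrivialBlock h∈H h≢e
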